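{- Let $h = \{\mathtt{return}\;x = \mathit{op}\;(),\ \mathit{op}\;x\;k = \mathtt{return}\;()\}$ and let $c_{ex4} = \mathtt{return}\;(\mathtt{rec}\;f = \lambda z.\mathtt{with}\;h\;\mathtt{handle}\;f\,())$. Then $c_{ex4}$ is $\vdash_{\mathrm{st}}$-typable (namely $\vdash_{\mathrm{st}} c_{ex4} : \mathtt{unit}\to\mathtt{unit}$ under the simple signature $\Sigma(\mathit{op}) = \mathtt{unit}\to\mathtt{unit}$), but there is no ATM signature $\Sigma'$ and value type $\tau$ such that $\vdash_{\mathrm{atm}} c_{ex4} : \tau/\square$ under $\Sigma'$ (in the empty environment).
   Context: Syntax. Values $v ::= x \mid () \mid \mathtt{true} \mid \mathtt{false} \mid \lambda x.c \mid \mathtt{rec}\;x = v$; computations $c ::= \mathtt{return}\;v \mid \mathit{op}\;v \mid v_1\,v_2 \mid \mathtt{if}\;v\;\mathtt{then}\;c_1\;\mathtt{else}\;c_2 \mid \mathtt{let}\;x = c_1\;\mathtt{in}\;c_2 \mid \mathtt{with}\;h\;\mathtt{handle}\;c$; handlers $h ::= \{\mathtt{return}\;x = c,\ \mathit{op}_1\,x_1\,k_1 = c_1, \dots\}$. Inside $\lambda z.\ldots$ the body $\mathtt{with}\;h\;\mathtt{handle}\;f\,()$ is a computation. Simple type system $\vdash_{\mathrm{st}}$: types $\sigma ::= \mathtt{unit}\mid\mathtt{bool}\mid\sigma_1\to\sigma_2$; a simple signature $\Sigma$ assigns each operation a type $\sigma\to\sigma'$. Rules: $\Gamma\vdash():\mathtt{unit}$;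 $\Gamma\vdash\mathtt{true},\mathtt{false}:\mathtt{bool}$; $\Gamma\vdash x:\sigma$ if $x:\sigma\in\Gamma$; $\Gamma\vdash\lambda x.c:\sigma\to\sigma'$ if $\Gamma,x:\sigma\vdash c:\sigma'$; $\Gamma\vdash\mathtt{rec}\;x=v:\sigma$ if $\Gamma,x:\sigma\vdash v:\sigma$; if-rule with $\mathtt{bool}$ guard and equal branch types; $\Gamma\vdash v_1 v_2:\sigma'$ if $\Gamma\vdash v_1:\sigma\to\sigma'$, $\Gamma\vdash v_2:\sigma$; $\Gamma\vdash\mathtt{let}\;x=c_1\;\mathtt{in}\;c_2:\sigma'$ if $\Gamma\vdash c_1:\sigma$ and $\Gamma,x:\sigma\vdash c_2:\sigma'$; $\Gamma\vdash\mathtt{return}\;v:\sigma$ if $\Gamma\vdash v:\sigma$; $\Gamma\vdash\mathit{op}\;v:\sigma'$ if $\Sigma(\mathit{op})=\sigma\to\sigma'$ and $\Gamma\vdash v:\sigma$; $\Gamma\vdash\{\mathtt{return}\;x=c,\overline{\mathit{op}_i\,x_i\,k_i=c_i}\}:\sigma\to\sigma'$ if $\Gamma,x:\sigma\vdash c:\sigma'$ and for each $i$, $\Sigma(\mathit{op}_i)=\sigma_i\to\sigma_i'$ and $\Gamma,x_i:\sigma_i,k_i:\sigma_i'\to\sigma'\vdash c_i:\sigma'$; $\Gamma\vdash\mathtt{with}\;h\;\mathtt{handle}\;c:\sigma'$ if $\Gamma\vdash h:\sigma\to\sigma'$ and $\Gamma\vdash c:\sigma$. A program $c$ is $\vdash_{\mathrm{st}}$-typable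 if $\vdash_{\mathrm{st}} c:\sigma$ for some $\sigma$. ATM types: $b ::= \mathtt{unit} \mid \mathtt{bool}$; $\tau ::= b \mid \tau \to \rho$; $\rho ::= \tau/\square \mid \tau/\rho_1 \Rightarrow \rho_2$. An ATM signature assigns each operation a type $\tau\to\tau'/\rho_1\Rightarrow\rho_2$. Subtyping $\le$: $b \le b$; $\tau_1\to\rho_1 \le \tau_2\to\rho_2$ if $\tau_2\le\tau_1$, $\rho_1\le\rho_2$; $\tau_1/\square \le \tau_2/\square$ if $\tau_1\le\tau_2$; $\tau_1/\rho_1\Rightarrow\rho_1' \le \tau_2/\rho_2\Rightarrow\rho_2'$ if $\tau_1\le\tau_2$, $\rho_2\le\rho_1$, $\rho_1'\le\rho_2'$; $\tau_1/\square \le \tau_2/\rho_1\Rightarrow\rho_2$ if $\tau_1\le\tau_2$, $\rho_1\le\rho_2$. Typing $\vdash_{\mathrm{atm}}$: $\Gamma\vdash ():\mathtt{unit}$; $\Gamma\vdash\mathtt{true},\mathtt{false}:\mathtt{bool}$; $\Gamma\vdash x:\tau$ if $x:\tau\in\Gamma$; $\Gamma\vdash\lambda x.c:\tau\to\rho$ if $\Gamma,x:\tau\vdash c:\rho$; $\Gamma\vdash\mathtt{rec}\;x=v:\tau$ if $\Gamma,x:\tau\vdash v:\tau$; $\Gamma\vdash\mathtt{if}\;v\;\mathtt{then}\;c_1\;\mathtt{else}\;c_2:\rho$ if $\Gamma\vdash v:\mathtt{bool}$, $\Gamma\vdash c_1:\rho$, $\Gamma\vdash c_2:\rho$; $\Gamma\vdash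 v_1\,v_2:\rho$ if $\Gamma\vdash v_1:\tau\to\rho$, $\Gamma\vdash v_2:\tau$; $\Gamma\vdash\mathtt{let}\;x=c_1\;\mathtt{in}\;c_2:\tau_2/\square$ if $\Gamma\vdash c_1:\tau_1/\square$, $\Gamma,x:\tau_1\vdash c_2:\tau_2/\square$; $\Gamma\vdash\mathtt{let}\;x=c_1\;\mathtt{in}\;c_2:\tau_2/\rho_2\Rightarrow\rho_1'$ if $\Gamma\vdash c_1:\tau_1/\rho_1\Rightarrow\rho_1'$, $\Gamma,x:\tau_1\vdash c_2:\tau_2/\rho_2\Rightarrow\rho_1$; $\Gamma\vdash\mathtt{return}\;v:\tau/\square$ if $\Gamma\vdash v:\tau$; $\Gamma\vdash\mathit{op}\;v:\tau'/\rho_1\Rightarrow\rho_2$ if $\Sigma(\mathit{op})=\tau\to\tau'/\rho_1\Rightarrow\rho_2$, $\Gamma\vdash v:\tau$; $\Gamma\vdash\{\mathtt{return}\;x=c,\overline{\mathit{op}_i\,x_i\,k_i=c_i}\}$ if for each $i$, $\Sigma(\mathit{op}_i)=\tau_i\to\tau_i'/\rho_i\Rightarrow\rho_i'$ and $\Gamma,x_i:\tau_i,k_i:\tau_i'\to\rho_i\vdash c_i:\rho_i'$; $\Gamma\vdash\mathtt{with}\;h\;\mathtt{handle}\;c:\rho'$ if $\Gamma\vdash h$, $\Gamma\vdash c:\tau/\rho\Rightarrow\rho'$, $\Gamma,x:\tau\vdash c':\rho$ where $\mathtt{return}\;x=c'$ is the return clause of $h$; $\Gamma\vdash v:\tau'$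 if $\Gamma\vdash v:\tau$, $\tau\le\tau'$; $\Gamma\vdash c:\rho'$ if $\Gamma\vdash c:\rho$, $\rho\le\rho'$. -}

module Defs where

open import Data.Nat using (ℕ; zero; suc)
open import Data.List using (List; []; _∷_)
open import Data.Product using (_×_; _,_)
open import Relation.Binary.PropositionalEquality using (_≡_)

Op : Set
Op = ℕ

op : Op
op = 0

-- Syntax (de Bruijn indices; `lam`, `rec`, `let` bind one variable,
-- the return clause of a handler binds x, an operation clause binds
-- x_i (index 1) and then k_i (index 0)).

mutual
  data Val : Set where
    var   : ℕ → Val
    unit  : Val
    true  : Val
    false : Val
    lam   : Comp → Val
    rec   : Val → Val

  data Comp : Set where
    return  : Val → Comp
    perform : Op → Val → Comp
    app     : Val → Val → Comp
    if_then_else_ : Val → Comp → Comp → Comp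
    let-in  : Comp → Comp → Comp
    with-handle : Handler → Comp → Comp

  -- {return x = c, op₁ x₁ k₁ = c₁, ...}
  data Handler : Set where
    handler : Comp → List (Op × Comp) → Handler

data SType : Set where
  sunit : SType
  sbool : SType
  _⇒_   : SType → SType → SType

-- simple signature: op ↦ (σ , σ') meaning σ → σ'
SSig : Set
SSig = Op → SType × SType

data _∋_⦂_ {A : Set} : List A → ℕ → A → Set where
  here  : ∀ {Γ a} → (a ∷ Γ) ∋ zero ⦂ a
  there : ∀ {Γ a b n} → Γ ∋ n ⦂ a → (b ∷ Γ) ∋ suc n ⦂ a

module Simple (Σ : SSig) where
  mutual
    data _⊢v_⦂_ (Γ : List SType) : Val → SType → Set where
      t-unit  : Γ ⊢v unit ⦂ sunit
      t-true  : Γ ⊢v true ⦂ sbool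
      t-false : Γ ⊢v false ⦂ sbool
      t-var   : ∀ {n σ} → Γ ∋ n ⦂ σ → Γ ⊢v var n ⦂ σ
      t-lam   : ∀ {c σ σ'} → (σ ∷ Γ) ⊢c c ⦂ σ' → Γ ⊢v lam c ⦂ (σ ⇒ σ')
      t-rec   : ∀ {v σ} → (σ ∷ Γ) ⊢v v ⦂ σ → Γ ⊢v rec v ⦂ σ

    data _⊢c_⦂_ (Γ : List SType) : Comp → SType → Set where
      t-if     : ∀ {v c₁ c₂ σ} → Γ ⊢v v ⦂ sbool → Γ ⊢c c₁ ⦂ σ → Γ ⊢c c₂ ⦂ σ →
                 Γ ⊢c if v then c₁ else c₂ ⦂ σ
      t-app    : ∀ {v₁ v₂ σ σ'} → Γ ⊢v v₁ ⦂ (σ ⇒ σ') → Γ ⊢v v₂ ⦂ σ → Γ ⊢c app v₁ v₂ ⦂ σ'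
      t-let    : ∀ {c₁ c₂ σ σ'} → Γ ⊢c c₁ ⦂ σ → (σ ∷ Γ) ⊢c c₂ ⦂ σ' → Γ ⊢c let-in c₁ c₂ ⦂ σ'
      t-return : ∀ {v σ} → Γ ⊢v v ⦂ σ → Γ ⊢c return v ⦂ σ
      t-op     : ∀ {o v σ σ'} → Σ o ≡ (σ , σ') → Γ ⊢v v ⦂ σ → Γ ⊢c perform o v ⦂ σ'
      t-handle : ∀ {h c σ σ'} → Γ ⊢h h ⦂ σ ⟶ σ' → Γ ⊢c c ⦂ σ → Γ ⊢c with-handle h c ⦂ σ'

    data _⊢h_⦂_⟶_ (Γ : List SType) : Handler → SType → SType → Set where
      t-handler : ∀ {c cls σ σ'} → (σ ∷ Γ) ⊢c c ⦂ σ' → ClausesOK Γ cls σ' →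
                  Γ ⊢h handler c cls ⦂ σ ⟶ σ'

    data ClausesOK (Γ : List SType) : List (Op × Comp) → SType → Set where
      []  : ∀ {σ'} → ClausesOK Γ [] σ'
      _∷_ : ∀ {o c cls σᵢ σᵢ' σ'} →
            Σ o ≡ (σᵢ , σᵢ') × ((σᵢ' ⇒ σ') ∷ σᵢ ∷ Γ) ⊢c c ⦂ σ' →
            ClausesOK Γ cls σ' → ClausesOK Γ ((o , c) ∷ cls) σ'

data BTy : Set where
  bunit : BTy
  bbool : BTy

mutual
  data VTy : Set where
    base : BTy → VTy
    _⟶_  : VTy → CTy → VTy

  data CTy : Set where
    _/□      : VTy → CTy
    _/_⇛_    : VTy → CTy → CTy → CTy

-- ATM operation type τ → τ' / ρ₁ ⇒ ρ₂
record ATMOpTy : Set where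
  constructor opty
  field
    dom  : VTy
    cod  : VTy
    ans₁ : CTy
    ans₂ : CTy

ASig : Set
ASig = Op → ATMOpTy

mutual
  data _≤v_ : VTy → VTy → Set where
    ≤-base : ∀ {b} → base b ≤v base b
    ≤-fun  : ∀ {τ₁ τ₂ ρ₁ ρ₂} → τ₂ ≤v τ₁ → ρ₁ ≤c ρ₂ → (τ₁ ⟶ ρ₁) ≤v (τ₂ ⟶ ρ₂)

  data _≤c_ : CTy → CTy → Set where
    ≤-pure    : ∀ {τ₁ τ₂} → τ₁ ≤v τ₂ → (τ₁ /□) ≤c (τ₂ /□)
    ≤-ans     : ∀ {τ₁ τ₂ ρ₁ ρ₁' ρ₂ ρ₂'} → τ₁ ≤v τ₂ → ρ₂ ≤c ρ₁ → ρ₁' ≤c ρ₂' →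
                (τ₁ / ρ₁ ⇛ ρ₁') ≤c (τ₂ / ρ₂ ⇛ ρ₂')
    ≤-pure-ans : ∀ {τ₁ τ₂ ρ₁ ρ₂} → τ₁ ≤v τ₂ → ρ₁ ≤c ρ₂ → (τ₁ /□) ≤c (τ₂ / ρ₁ ⇛ ρ₂)

module ATM (Σ : ASig) where
  mutual
    data _⊢v_⦂_ (Γ : List VTy) : Val → VTy → Set where
      t-unit  : Γ ⊢v unit ⦂ base bunit
      t-true  : Γ ⊢v true ⦂ base bbool
      t-false : Γ ⊢v false ⦂ base bbool
      t-var   : ∀ {n τ} → Γ ∋ n ⦂ τ → Γ ⊢v var n ⦂ τ
      t-lam   : ∀ {c τ ρ} → (τ ∷ Γ) ⊢c c ⦂ ρ → Γ ⊢v lam c ⦂ (τ ⟶ ρ)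
      t-rec   : ∀ {v τ} → (τ ∷ Γ) ⊢v v ⦂ τ → Γ ⊢v rec v ⦂ τ
      t-subv  : ∀ {v τ τ'} → Γ ⊢v v ⦂ τ → τ ≤v τ' → Γ ⊢v v ⦂ τ'

    data _⊢c_⦂_ (Γ : List VTy) : Comp → CTy → Set where
      t-if     : ∀ {v c₁ c₂ ρ} → Γ ⊢v v ⦂ base bbool → Γ ⊢c c₁ ⦂ ρ → Γ ⊢c c₂ ⦂ ρ →
                 Γ ⊢c if v then c₁ else c₂ ⦂ ρ
      t-app    : ∀ {v₁ v₂ τ ρ} → Γ ⊢v v₁ ⦂ (τ ⟶ ρ) → Γ ⊢v v₂ ⦂ τ → Γ ⊢c app v₁ v₂ ⦂ ρ
      t-let-pure : ∀ {c₁ c₂ τ₁ τ₂} → Γ ⊢c c₁ ⦂ (τ₁ /□) → (τ₁ ∷ Γ) ⊢c c₂ ⦂ (τ₂ /□) →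
                   Γ ⊢c let-in c₁ c₂ ⦂ (τ₂ /□)
      t-let-ans  : ∀ {c₁ c₂ τ₁ τ₂ ρ₁ ρ₁' ρ₂} → Γ ⊢c c₁ ⦂ (τ₁ / ρ₁ ⇛ ρ₁') →
                   (τ₁ ∷ Γ) ⊢c c₂ ⦂ (τ₂ / ρ₂ ⇛ ρ₁) →
                   Γ ⊢c let-in c₁ c₂ ⦂ (τ₂ / ρ₂ ⇛ ρ₁')
      t-return : ∀ {v τ} → Γ ⊢v v ⦂ τ → Γ ⊢c return v ⦂ (τ /□)
      t-op     : ∀ {o v τ τ' ρ₁ ρ₂} → Σ o ≡ opty τ τ' ρ₁ ρ₂ → Γ ⊢v v ⦂ τ →
                 Γ ⊢c perform o v ⦂ (τ' / ρ₁ ⇛ ρ₂)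
      t-handle : ∀ {c' cls c τ ρ ρ'} → ClausesOK Γ cls → Γ ⊢c c ⦂ (τ / ρ ⇛ ρ') →
                 (τ ∷ Γ) ⊢c c' ⦂ ρ → Γ ⊢c with-handle (handler c' cls) c ⦂ ρ'
      t-subc   : ∀ {c ρ ρ'} → Γ ⊢c c ⦂ ρ → ρ ≤c ρ' → Γ ⊢c c ⦂ ρ'

    -- Γ ⊢ h : every operation clause is well typed (return clause is
    -- checked by the handle rule)
    data ClausesOK (Γ : List VTy) : List (Op × Comp) → Set where
      []  : ClausesOK Γ []
      _∷_ : ∀ {o c cls τᵢ τᵢ' ρᵢ ρᵢ'} →
            Σ o ≡ opty τᵢ τᵢ' ρᵢ ρᵢ' × ((τᵢ' ⟶ ρᵢ) ∷ τᵢ ∷ Γ) ⊢c c ⦂ ρᵢ' →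
            ClausesOK Γ cls → ClausesOK Γ ((o , c) ∷ cls)

-- h = {return x = op (), op x k = return ()}
h-ex4 : Handler
h-ex4 = handler (perform op unit) ((op , return unit) ∷ [])

-- c_ex4 = return (rec f = λ z. with h handle f ())
-- inside λ z, z is index 0 and f is index 1
c-ex4 : Comp
c-ex4 = return (rec (lam (with-handle h-ex4 (app (var 1) unit))))

-- Typing c-ex4 in the ATM system forces a cycle of subtyping constraints on the
-- answer types of the handled call f ().  If ρ' is the final answer type of
-- f () : τ / ρ ⇛ ρ', the body of f is typed at some ρb with ρ' ≤ ρb, and since
-- rec ties the type of f to the type of its own body, ρb ≤ τ / ρ ⇛ ρ'.  Hence
-- ρ' ≤ τ / ρ ⇛ ρ', and such a self-referential bound is only possible when the
-- initial answer type ρ is pure.  But ρ is the type of the return clause op (),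
-- and an operation call never has a pure type.
module Submission where

open import Defs
open import Data.List using ([]; _∷_)
open import Data.Product using (_×_; _,_; ∃-syntax)
open import Relation.Binary.PropositionalEquality as ≡ using (_≡_)
open import Relation.Binary.Bundles using (Preorder)
import Relation.Binary.Reasoning.Preorder
open import Relation.Nullary using (¬_)

≤v-refl : ∀ {τ} → τ ≤v τ
≤c-refl : ∀ {ρ} → ρ ≤c ρ
≤v-refl {base _}    = ≤-base
≤v-refl {_ ⟶ _}     = ≤-fun ≤v-refl ≤c-refl
≤c-refl {_ /□}      = ≤-pure ≤v-refl
≤c-refl {_ / _ ⇛ _} = ≤-ans ≤v-refl ≤c-refl ≤c-refl

≤v-trans : ∀ {τ₁ τ₂ τ₃} → τ₁ ≤v τ₂ → τ₂ ≤v τ₃ → τ₁ ≤v τ₃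
≤c-trans : ∀ {ρ₁ ρ₂ ρ₃} → ρ₁ ≤c ρ₂ → ρ₂ ≤c ρ₃ → ρ₁ ≤c ρ₃
≤v-trans ≤-base ≤-base = ≤-base
≤v-trans (≤-fun p q) (≤-fun r s) = ≤-fun (≤v-trans r p) (≤c-trans q s)
≤c-trans (≤-pure p) (≤-pure q) = ≤-pure (≤v-trans p q)
≤c-trans (≤-pure p) (≤-pure-ans q r) = ≤-pure-ans (≤v-trans p q) r
≤c-trans (≤-ans p q r) (≤-ans p' q' r') = ≤-ans (≤v-trans p p') (≤c-trans q' q) (≤c-trans r r')
≤c-trans (≤-pure-ans p q) (≤-ans p' q' r') = ≤-pure-ans (≤v-trans p p') (≤c-trans (≤c-trans q' q) r')

≤c-preorder : Preorder _ _ _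
≤c-preorder = record
  { Carrier    = CTy
  ; _≈_        = _≡_
  ; _≲_        = _≤c_
  ; isPreorder = record
    { isEquivalence = ≡.isEquivalence
    ; reflexive     = λ { ≡.refl → ≤c-refl }
    ; trans         = ≤c-trans
    }
  }

≤v-fun-cod : ∀ {τ₁ τ₂ ρ₁ ρ₂} → (τ₁ ⟶ ρ₁) ≤v (τ₂ ⟶ ρ₂) → ρ₁ ≤c ρ₂
≤v-fun-cod (≤-fun _ q) = q

IsPure : CTy → Set
IsPure ρ = ∃[ τ ] (ρ ≡ τ /□)

≤c-reflects-IsPure : ∀ {ρ₁ ρ₂} → ρ₁ ≤c ρ₂ → IsPure ρ₂ → IsPure ρ₁
≤c-reflects-IsPure (≤-pure _) _ = _ , ≡.refl

-- Induction on ρ: a bound ρ ≤ τ₁ / ρ₁ ⇛ ρ with ρ = τ / ρ₂ ⇛ ρ₃ yields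
-- ρ₁ ≤ ρ₂ together with the smaller self-referential bound ρ₃ ≤ τ / ρ₂ ⇛ ρ₃.
self-bounded⇒initial-pure : ∀ {ρ τ₁ ρ₁} → ρ ≤c (τ₁ / ρ₁ ⇛ ρ) → IsPure ρ₁
self-bounded⇒initial-pure {_ /□} (≤-pure-ans _ ρ₁≤ρ) = ≤c-reflects-IsPure ρ₁≤ρ (_ , ≡.refl)
self-bounded⇒initial-pure {_ / _ ⇛ _} (≤-ans _ ρ₁≤ρ₂ ρ₃≤ρ) =
  ≤c-reflects-IsPure ρ₁≤ρ₂ (self-bounded⇒initial-pure ρ₃≤ρ)

module _ (Σ : ASig) where
  open ATM Σ

  perform-¬IsPure : ∀ {Γ o v ρ} → Γ ⊢c perform o v ⦂ ρ → ¬ IsPure ρ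
  perform-¬IsPure (t-op _ _) (_ , ())
  perform-¬IsPure (t-subc ⊢c ρ≤ρ') pure = perform-¬IsPure ⊢c (≤c-reflects-IsPure ρ≤ρ' pure)

  return-inv : ∀ {Γ v ρ} → Γ ⊢c return v ⦂ ρ → ∃[ τ ] (Γ ⊢v v ⦂ τ)
  return-inv (t-return ⊢v)  = _ , ⊢v
  return-inv (t-subc ⊢c _) = return-inv ⊢c

  rec-inv : ∀ {Γ v τ} → Γ ⊢v rec v ⦂ τ → ∃[ τ' ] ((τ' ∷ Γ) ⊢v v ⦂ τ')
  rec-inv (t-rec ⊢v)    = _ , ⊢v
  rec-inv (t-subv ⊢v _) = rec-inv ⊢v

  lam-inv : ∀ {Γ c τ} → Γ ⊢v lam c ⦂ τ →
            ∃[ τ' ] ∃[ ρ ] ((τ' ∷ Γ) ⊢c c ⦂ ρ × (τ' ⟶ ρ) ≤v τ)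
  lam-inv (t-lam ⊢c) = _ , _ , ⊢c , ≤v-refl
  lam-inv (t-subv ⊢v τ₁≤τ₂) with lam-inv ⊢v
  ... | τ' , ρ , ⊢c , ≤τ₁ = τ' , ρ , ⊢c , ≤v-trans ≤τ₁ τ₁≤τ₂

  var-inv : ∀ {Γ n τ} → Γ ⊢v var n ⦂ τ → ∃[ τ' ] (Γ ∋ n ⦂ τ' × τ' ≤v τ)
  var-inv (t-var x) = _ , x , ≤v-refl
  var-inv (t-subv ⊢v τ₁≤τ₂) with var-inv ⊢v
  ... | τ' , x , ≤τ₁ = τ' , x , ≤v-trans ≤τ₁ τ₁≤τ₂

  app-inv : ∀ {Γ v₁ v₂ ρ} → Γ ⊢c app v₁ v₂ ⦂ ρ →
            ∃[ τ ] ∃[ ρ' ] (Γ ⊢v v₁ ⦂ (τ ⟶ ρ') × ρ' ≤c ρ)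
  app-inv (t-app ⊢v₁ _) = _ , _ , ⊢v₁ , ≤c-refl
  app-inv (t-subc ⊢c ρ₁≤ρ₂) with app-inv ⊢c
  ... | τ , ρ' , ⊢v₁ , ≤ρ₁ = τ , ρ' , ⊢v₁ , ≤c-trans ≤ρ₁ ρ₁≤ρ₂

  handle-inv : ∀ {Γ c' cls c ρ₀} → Γ ⊢c with-handle (handler c' cls) c ⦂ ρ₀ →
               ∃[ τ ] ∃[ ρ ] ∃[ ρ' ]
                 (Γ ⊢c c ⦂ (τ / ρ ⇛ ρ') × (τ ∷ Γ) ⊢c c' ⦂ ρ × ρ' ≤c ρ₀)
  handle-inv (t-handle _ ⊢c ⊢c') = _ , _ , _ , ⊢c , ⊢c' , ≤c-refl
  handle-inv (t-subc ⊢h ρ₁≤ρ₂) with handle-inv ⊢h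
  ... | τ , ρ , ρ' , ⊢c , ⊢c' , ≤ρ₁ = τ , ρ , ρ' , ⊢c , ⊢c' , ≤c-trans ≤ρ₁ ρ₁≤ρ₂

  c-ex4-¬pure : ∀ {τ} → ¬ ([] ⊢c c-ex4 ⦂ (τ /□))
  c-ex4-¬pure ⊢c-ex4 with return-inv ⊢c-ex4
  ... | _ , ⊢rec with rec-inv ⊢rec
  ... | _ , ⊢lam with lam-inv ⊢lam
  ... | _ , ρb , ⊢body , lam≤τf with handle-inv ⊢body
  ... | τ , ρ , ρ' , ⊢call , ⊢op , ρ'≤ρb with app-inv ⊢call
  ... | _ , ρa , ⊢f , ρa≤ with var-inv ⊢f
  ... | _ , there here , τf≤ = perform-¬IsPure ⊢op (self-bounded⇒initial-pure ρ'≤τ/ρ⇛ρ')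
    where
    open Relation.Binary.Reasoning.Preorder ≤c-preorder
    ρ'≤τ/ρ⇛ρ' : ρ' ≤c (τ / ρ ⇛ ρ')
    ρ'≤τ/ρ⇛ρ' = begin
      ρ'            ≲⟨ ρ'≤ρb ⟩
      ρb            ≲⟨ ≤v-fun-cod (≤v-trans lam≤τf τf≤) ⟩
      ρa            ≲⟨ ρa≤ ⟩
      τ / ρ ⇛ ρ'    ∎

c-ex4-⊢st : (Σ : SSig) → Σ op ≡ (sunit , sunit) → Simple._⊢c_⦂_ Σ [] c-ex4 (sunit ⇒ sunit)
c-ex4-⊢st Σ op⦂unit⇒unit =
  t-return (t-rec (t-lam (t-handle
    (t-handler (t-op op⦂unit⇒unit t-unit) ((op⦂unit⇒unit , t-return t-unit) ∷ []))
    (t-app (t-var (there here)) t-unit))))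
  where open Simple Σ

mainTheorem5 : ((Σ : SSig) → Σ op ≡ (sunit , sunit) →
                  Simple._⊢c_⦂_ Σ [] c-ex4 (sunit ⇒ sunit))
               × (¬ (∃[ Σ' ] ∃[ τ ] ATM._⊢c_⦂_ Σ' [] c-ex4 (τ /□)))
mainTheorem5 = c-ex4-⊢st , λ { (Σ' , _ , ⊢c-ex4) → c-ex4-¬pure Σ' ⊢c-ex4 }
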